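{- Let $m\geq 2$ and $n\geq 0$ be integers and let $f_{m,n}(z)=\sum_{j=0}^{n}\binom{n}{j}z^{\binom{j}{m}}$. If $r\in\mathbb{Q}$ is a root of $f_{m,n}(z)$, then either $r=-1$, or $n=m$ and $r=1-2^m$ (which is indeed the root of $f_{m,m}(z)=z+2^m-1$).
   Context: Here $\binom{j}{m}=0$ for $0\le j<m$. -}

module Defs where

open import Data.Nat using (ℕ; zero; suc)
open import Data.Nat.Combinatorics using (_C_)
open import Data.Integer using (+_)
open import Data.Rational using (ℚ; 0ℚ; 1ℚ; _+_; _*_; _/_)

_^ℚ_ : ℚ → ℕ → ℚ
q ^ℚ zero = 1ℚ
q ^ℚ suc k = q * (q ^ℚ k)

ℕ→ℚ : ℕ → ℚ
ℕ→ℚ k = + k / 1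

sumTo : ℕ → (ℕ → ℚ) → ℚ
sumTo zero g = g 0
sumTo (suc n) g = sumTo n g + g (suc n)

-- f_{m,n}(z) = Σ_{j=0}^{n} C(n,j) z^{C(j,m)}   (stdlib: j C m = 0 when j < m)
f : ℕ → ℕ → ℚ → ℚ
f m n z = sumTo n (λ j → ℕ→ℚ (n C j) * (z ^ℚ (j C m)))

-- For n < m every exponent j C m vanishes and f m n is the constant 2 ^ n; for n = m it is
-- the linear polynomial (2 ^ m - 1) + z.  For n > m, f m n is a monic polynomial with integer
-- coefficients (the j = n term has exponent n C m, strictly larger than all others), so by the
-- rational root theorem a rational root is an integer p.  Then p ≥ 0 is impossible since all
-- terms are nonnegative and the constant term is 1; p = -2 is impossible since
-- f m n (-2) ≡ f m n 1 = 2 ^ n (mod 3); and |p| ≥ 3 is impossible because the leading term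
-- |p| ^ (n C m) = |p| ^ ((n-1) C m) · |p| ^ ((n-1) C (m-1)) exceeds (2 ^ n - 1) · |p| ^ ((n-1) C m),
-- a bound for all the other terms together, as 2 ^ n ≤ 3 ^ (n-1) ≤ 3 ^ ((n-1) C (m-1)).
module Submission where

open import Defs
open import Data.Nat using (ℕ; _≥_)
open import Data.Rational using (ℚ; 0ℚ; 1ℚ; -_; _-_)
open import Data.Sum using (_⊎_)
open import Data.Product using (_×_)
open import Relation.Binary.PropositionalEquality using (_≡_)

open import Algebra.Bundles using (AbelianGroup; CommutativeMonoid)
import Algebra.Properties.CommutativeSemigroup as CommSemigroupProperties
import Algebra.Properties.Group as GroupProperties
open import Data.Empty using (⊥-elim)
open import Data.Integer as ℤ using (ℤ; +_; -[1+_]; 0ℤ; 1ℤ; -1ℤ)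
open import Data.Integer.Divisibility.Signed
  using (_∣_; divides; ∣-refl; ∣m∣n⇒∣m+n; ∣m+n∣m⇒∣n; ∣n⇒∣m*n; ∣m⇒∣m*n; ∣⇒∣ᵤ)
import Data.Integer.Properties as ℤP
open import Data.Integer.Tactic.RingSolver using (solve-∀)
open import Data.Nat as ℕ using (zero; suc; z≤n; s≤s; _≤_; _<_; _∸_)
open import Data.Nat.Combinatorics
  using (_C_; nCn≡1; nC1≡n; k>n⇒nCk≡0) renaming (nCk+nC[k+1]≡[n+1]C[k+1] to pascal)
import Data.Nat.Coprimality as Coprimality
import Data.Nat.Divisibility as ℕ∣
import Data.Nat.Properties as ℕP
open import Data.Product using (_,_)
open import Data.Rational as ℚ using (mkℚ; _/_; ↥_; ↧ₙ_)
import Data.Rational.Properties as ℚP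
open import Data.Rational.Solver using (module +-*-Solver)
import Data.Rational.Unnormalised as ℚᵘ
import Data.Rational.Unnormalised.Properties as ℚᵘP
open import Data.Sum using (inj₁; inj₂)
open import Relation.Binary.Definitions using (tri<; tri≈; tri>)
open import Relation.Binary.PropositionalEquality
  using (refl; sym; trans; cong; cong₂; subst; subst₂; _≢_; module ≡-Reasoning)
open import Relation.Nullary.Decidable using (toWitness)
open import Relation.Nullary.Negation using (¬_)

module ℕ+ = CommSemigroupProperties ℕP.+-commutativeSemigroup
module ℚ* = CommSemigroupProperties
  (CommutativeMonoid.commutativeSemigroup ℚP.*-1-commutativeMonoid)
module ℤ+ = GroupProperties (AbelianGroup.group ℤP.+-0-abelianGroup)

module _ {A : Set} (_∙_ : A → A → A) where

  Σ≤ : ℕ → (ℕ → A) → A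
  Σ≤ zero    g = g 0
  Σ≤ (suc n) g = Σ≤ n g ∙ g (suc n)

  Σ≤-cong : ∀ n {g h} → (∀ j → j ≤ n → g j ≡ h j) → Σ≤ n g ≡ Σ≤ n h
  Σ≤-cong zero    g≡h = g≡h 0 z≤n
  Σ≤-cong (suc n) g≡h =
    cong₂ _∙_ (Σ≤-cong n (λ j j≤n → g≡h j (ℕP.m≤n⇒m≤1+n j≤n))) (g≡h (suc n) ℕP.≤-refl)

Σ≤-homo : ∀ {A B : Set} {_∙_ : A → A → A} {_⊕_ : B → B → B} (h : A → B) →
          (∀ x y → h (x ∙ y) ≡ h x ⊕ h y) →
          ∀ n g → h (Σ≤ _∙_ n g) ≡ Σ≤ _⊕_ n (λ j → h (g j))
Σ≤-homo h homo zero    g = refl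
Σ≤-homo {_⊕_ = _⊕_} h homo (suc n) g =
  trans (homo _ _) (cong (_⊕ h (g (suc n))) (Σ≤-homo h homo n g))

Σℕ : ℕ → (ℕ → ℕ) → ℕ
Σℕ = Σ≤ ℕ._+_

Σℤ : ℕ → (ℕ → ℤ) → ℤ
Σℤ = Σ≤ ℤ._+_

sumTo≡Σ≤ : ∀ n g → sumTo n g ≡ Σ≤ ℚ._+_ n g
sumTo≡Σ≤ zero    g = refl
sumTo≡Σ≤ (suc n) g = cong (ℚ._+ g (suc n)) (sumTo≡Σ≤ n g)

Σℕ-head≤ : ∀ n g → g 0 ≤ Σℕ n g
Σℕ-head≤ zero    g = ℕP.≤-refl
Σℕ-head≤ (suc n) g = ℕP.≤-trans (Σℕ-head≤ n g) (ℕP.m≤m+n (Σℕ n g) (g (suc n)))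

Σℕ-mono-≤ : ∀ n {g h} → (∀ j → j ≤ n → g j ≤ h j) → Σℕ n g ≤ Σℕ n h
Σℕ-mono-≤ zero    g≤h = g≤h 0 z≤n
Σℕ-mono-≤ (suc n) g≤h =
  ℕP.+-mono-≤ (Σℕ-mono-≤ n (λ j j≤n → g≤h j (ℕP.m≤n⇒m≤1+n j≤n))) (g≤h (suc n) ℕP.≤-refl)

∣Σℤ∣≤Σℕ∣∣ : ∀ n g → ℤ.∣ Σℤ n g ∣ ≤ Σℕ n (λ j → ℤ.∣ g j ∣)
∣Σℤ∣≤Σℕ∣∣ zero    g = ℕP.≤-refl
∣Σℤ∣≤Σℕ∣∣ (suc n) g =
  ℕP.≤-trans (ℤP.∣i+j∣≤∣i∣+∣j∣ (Σℤ n g) (g (suc n))) (ℕP.+-monoˡ-≤ _ (∣Σℤ∣≤Σℕ∣∣ n g))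

∣-Σℤ : ∀ {k} n g → (∀ j → j ≤ n → k ∣ g j) → k ∣ Σℤ n g
∣-Σℤ zero    g k∣g = k∣g 0 z≤n
∣-Σℤ (suc n) g k∣g =
  ∣m∣n⇒∣m+n (∣-Σℤ n g (λ j j≤n → k∣g j (ℕP.m≤n⇒m≤1+n j≤n))) (k∣g (suc n) ℕP.≤-refl)

pos-^ : ∀ a k → + (a ℕ.^ k) ≡ (+ a) ℤ.^ k
pos-^ a zero    = refl
pos-^ a (suc k) = trans (ℤP.pos-* a (a ℕ.^ k)) (cong (+ a ℤ.*_) (pos-^ a k))

abs-^ : ∀ a k → ℤ.∣ a ℤ.^ k ∣ ≡ ℤ.∣ a ∣ ℕ.^ k
abs-^ a zero    = refl
abs-^ a (suc k) = trans (ℤP.abs-* a (a ℤ.^ k)) (cong (ℤ.∣ a ∣ ℕ.*_) (abs-^ a k))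

m-1∣m^k-1 : ∀ m k → m ℤ.- 1ℤ ∣ m ℤ.^ k ℤ.- 1ℤ
m-1∣m^k-1 m zero    = divides 0ℤ (sym (ℤP.*-zeroˡ (m ℤ.- 1ℤ)))
m-1∣m^k-1 m (suc k) =
  subst (m ℤ.- 1ℤ ∣_) (regroup m (m ℤ.^ k)) (∣m∣n⇒∣m+n (∣n⇒∣m*n m (m-1∣m^k-1 m k)) ∣-refl)
  where
  regroup : ∀ m x → m ℤ.* (x ℤ.- 1ℤ) ℤ.+ (m ℤ.- 1ℤ) ≡ m ℤ.* x ℤ.- 1ℤ
  regroup = solve-∀

coprime-∣^⇒∣1 : ∀ {a b} N → Coprimality.Coprime a b → a ℕ∣.∣ b ℕ.^ N → a ℕ∣.∣ 1
coprime-∣^⇒∣1 zero    _   a∣1     = a∣1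
coprime-∣^⇒∣1 (suc N) a⊥b a∣b^1+N = coprime-∣^⇒∣1 N a⊥b (Coprimality.coprime-divisor a⊥b a∣b^1+N)

3∤2^n : ∀ n → ¬ 3 ℕ∣.∣ 2 ℕ.^ n
3∤2^n n 3∣2^n with ℕ∣.∣1⇒≡1 (coprime-∣^⇒∣1 n (toWitness {a? = Coprimality.coprime? 3 2} _) 3∣2^n)
... | ()

Σℕ-C-pascal : ∀ n b → Σℕ (suc b) (suc n C_) ≡ Σℕ b (n C_) ℕ.+ Σℕ (suc b) (n C_)
Σℕ-C-pascal n zero    = cong suc (sym (pascal n 0))
Σℕ-C-pascal n (suc b) = begin
  Σℕ (suc b) (suc n C_) ℕ.+ suc n C suc (suc b)
    ≡⟨ cong₂ ℕ._+_ (Σℕ-C-pascal n b) (sym (pascal n (suc b))) ⟩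
  (Σℕ b (n C_) ℕ.+ Σℕ (suc b) (n C_)) ℕ.+ (n C suc b ℕ.+ n C suc (suc b))
    ≡⟨ ℕ+.interchange (Σℕ b (n C_)) _ _ _ ⟩
  (Σℕ b (n C_) ℕ.+ n C suc b) ℕ.+ (Σℕ (suc b) (n C_) ℕ.+ n C suc (suc b)) ∎
  where open ≡-Reasoning

binomial-sum : ∀ n → Σℕ n (n C_) ≡ 2 ℕ.^ n
binomial-sum zero    = refl
binomial-sum (suc n) = begin
  Σℕ (suc n) (suc n C_)       ≡⟨ Σℕ-C-pascal n n ⟩
  s ℕ.+ (s ℕ.+ n C suc n)     ≡⟨ cong (λ x → s ℕ.+ (s ℕ.+ x)) (k>n⇒nCk≡0 (ℕP.n<1+n n)) ⟩
  s ℕ.+ (s ℕ.+ 0)             ≡⟨ cong (λ x → x ℕ.+ (x ℕ.+ 0)) (binomial-sum n) ⟩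
  2 ℕ.^ suc n                 ∎
  where
  open ≡-Reasoning
  s = Σℕ n (n C_)

nCk>0 : ∀ {n k} → k ≤ n → 0 < n C k
nCk>0 {n}     {zero}  _         = ℕP.≤-refl
nCk>0 {suc n} {suc k} (s≤s k≤n) =
  ℕP.<-≤-trans (nCk>0 k≤n) (ℕP.≤-trans (ℕP.m≤m+n (n C k) _) (ℕP.≤-reflexive (pascal n k)))

nCk≤[1+n]Ck : ∀ n k → n C k ≤ suc n C k
nCk≤[1+n]Ck n zero    = ℕP.≤-refl
nCk≤[1+n]Ck n (suc k) = ℕP.≤-trans (ℕP.m≤n+m _ (n C k)) (ℕP.≤-reflexive (pascal n k))

nCk<[1+n]Ck : ∀ {n k} → 0 < k → k ≤ n → n C k < suc n C k
nCk<[1+n]Ck {n} {suc k} _ k<n = begin-strict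
  n C suc k                 <⟨ ℕP.m<n+m (n C suc k) (nCk>0 (ℕP.<⇒≤ k<n)) ⟩
  n C k ℕ.+ n C suc k       ≡⟨ pascal n k ⟩
  suc n C suc k             ∎
  where open ℕP.≤-Reasoning

C-monoˡ-≤ : ∀ k {m n} → m ≤ n → m C k ≤ n C k
C-monoˡ-≤ k m≤n = go (ℕP.≤⇒≤′ m≤n)
  where
  go : ∀ {m n} → m ℕ.≤′ n → m C k ≤ n C k
  go ℕ.≤′-refl        = ℕP.≤-refl
  go (ℕ.≤′-step m≤′n) = ℕP.≤-trans (go m≤′n) (nCk≤[1+n]Ck _ k)

n≤nCk : ∀ {n k} → 0 < k → k < n → n ≤ n C k
n≤nCk {suc n} {suc zero}    _ _           = ℕP.≤-reflexive (sym (nC1≡n (suc n)))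
n≤nCk {suc n} {suc (suc k)} _ (s≤s k<n) = begin
  suc n                           ≡⟨ ℕP.+-comm 1 n ⟩
  n ℕ.+ 1                         ≤⟨ ℕP.+-mono-≤ (n≤nCk (s≤s z≤n) k<n) (nCk>0 k<n) ⟩
  n C suc k ℕ.+ n C suc (suc k)   ≡⟨ pascal n (suc k) ⟩
  suc n C suc (suc k)             ∎
  where open ℕP.≤-Reasoning

2^[1+n]≤3^n : ∀ n → 2 ≤ n → 2 ℕ.^ suc n ≤ 3 ℕ.^ n
2^[1+n]≤3^n 1                   (s≤s ())
2^[1+n]≤3^n 2                   _ = toWitness {a? = 8 ℕ.≤? 9} _
2^[1+n]≤3^n (suc (suc (suc n))) _ =
  ℕP.*-mono-≤ (ℕP.n≤1+n 2) (2^[1+n]≤3^n (suc (suc n)) (s≤s (s≤s z≤n)))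

2^[1+n]≤3^nCk : ∀ {n k} → 0 < k → k < n → 2 ℕ.^ suc n ≤ 3 ℕ.^ (n C k)
2^[1+n]≤3^nCk {n} 0<k k<n =
  ℕP.≤-trans (2^[1+n]≤3^n n (ℕP.≤-trans (s≤s 0<k) k<n)) (ℕP.^-monoʳ-≤ 3 (n≤nCk 0<k k<n))

ℤ→ℚ : ℤ → ℚ
ℤ→ℚ a = a / 1

ℤ→ℚ≡mkℚ : ∀ a → ℤ→ℚ a ≡ mkℚ a 0 (Coprimality.sym (Coprimality.1-coprimeTo ℤ.∣ a ∣))
ℤ→ℚ≡mkℚ a = ℚP.↥p/↧p≡p (mkℚ a 0 _)

ℤ→ℚ-injective : ∀ {a b} → ℤ→ℚ a ≡ ℤ→ℚ b → a ≡ b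
ℤ→ℚ-injective {a} {b} eq = cong ↥_ (trans (sym (ℤ→ℚ≡mkℚ a)) (trans eq (ℤ→ℚ≡mkℚ b)))

-- On denominator 1, ℚ's _+_ and _*_ compute to the integer operations up to factors 1.
ℤ→ℚ-homo-+ : ∀ a b → ℤ→ℚ (a ℤ.+ b) ≡ ℤ→ℚ a ℚ.+ ℤ→ℚ b
ℤ→ℚ-homo-+ a b = trans (cong ℤ→ℚ (times-one a b)) (cong₂ ℚ._+_ (sym (ℤ→ℚ≡mkℚ a)) (sym (ℤ→ℚ≡mkℚ b)))
  where
  times-one : ∀ a b → a ℤ.+ b ≡ a ℤ.* + 1 ℤ.+ b ℤ.* + 1
  times-one = solve-∀

ℤ→ℚ-homo-* : ∀ a b → ℤ→ℚ (a ℤ.* b) ≡ ℤ→ℚ a ℚ.* ℤ→ℚ b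
ℤ→ℚ-homo-* a b = cong₂ ℚ._*_ (sym (ℤ→ℚ≡mkℚ a)) (sym (ℤ→ℚ≡mkℚ b))

ℤ→ℚ-homo-^ : ∀ a k → ℤ→ℚ (a ℤ.^ k) ≡ ℤ→ℚ a ^ℚ k
ℤ→ℚ-homo-^ a zero    = refl
ℤ→ℚ-homo-^ a (suc k) = trans (ℤ→ℚ-homo-* a (a ℤ.^ k)) (cong (ℤ→ℚ a ℚ.*_) (ℤ→ℚ-homo-^ a k))

ℕ→ℚ-homo-+ : ∀ a b → ℕ→ℚ (a ℕ.+ b) ≡ ℕ→ℚ a ℚ.+ ℕ→ℚ b
ℕ→ℚ-homo-+ a b = trans (cong ℤ→ℚ (ℤP.pos-+ a b)) (ℤ→ℚ-homo-+ (+ a) (+ b))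

ℕ→ℚ-homo-^ : ∀ a k → ℕ→ℚ (a ℕ.^ k) ≡ ℕ→ℚ a ^ℚ k
ℕ→ℚ-homo-^ a k = trans (cong ℤ→ℚ (pos-^ a k)) (ℤ→ℚ-homo-^ (+ a) k)

↧*q≡↥ : ∀ q → ℤ→ℚ (+ ↧ₙ q) ℚ.* q ≡ ℤ→ℚ (↥ q)
↧*q≡↥ q@(mkℚ p d _) = begin
  ℤ→ℚ (+ suc d) ℚ.* q   ≡⟨ cong (ℚ._* q) (ℤ→ℚ≡mkℚ (+ suc d)) ⟩
  [1+d]/1 ℚ.* q
    ≡⟨ ℚP.toℚᵘ-injective (ℚᵘP.≃-trans (ℚP.toℚᵘ-homo-* [1+d]/1 q) (ℚᵘ.*≡* cross-multiply)) ⟩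
  mkℚ p 0 _             ≡⟨ ℤ→ℚ≡mkℚ p ⟨
  ℤ→ℚ p                 ∎
  where
  open ≡-Reasoning
  [1+d]/1 = mkℚ (+ suc d) 0 (Coprimality.sym (Coprimality.1-coprimeTo (suc d)))
  swap : ∀ D p → (D ℤ.* p) ℤ.* + 1 ≡ p ℤ.* D
  swap = solve-∀
  cross-multiply : (+ suc d ℤ.* p) ℤ.* + 1 ≡ p ℤ.* + suc (d ℕ.+ 0)
  cross-multiply = trans (swap (+ suc d) p) (cong (λ x → p ℤ.* + suc x) (sym (ℕP.+-identityʳ d)))

^ℚ-homo-+ : ∀ q a b → q ^ℚ (a ℕ.+ b) ≡ q ^ℚ a ℚ.* q ^ℚ b
^ℚ-homo-+ q zero    b = sym (ℚP.*-identityˡ _)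
^ℚ-homo-+ q (suc a) b = trans (cong (q ℚ.*_) (^ℚ-homo-+ q a b)) (sym (ℚP.*-assoc q _ _))

^ℚ-distrib-* : ∀ q r k → (q ℚ.* r) ^ℚ k ≡ q ^ℚ k ℚ.* r ^ℚ k
^ℚ-distrib-* q r zero    = refl
^ℚ-distrib-* q r (suc k) =
  trans (cong ((q ℚ.* r) ℚ.*_) (^ℚ-distrib-* q r k)) (ℚ*.interchange q r _ _)

↧^N*q^e≡↥^e*↧^[N∸e] : ∀ q {N e} → e ≤ N →
  ℤ→ℚ (+ ↧ₙ q) ^ℚ N ℚ.* q ^ℚ e ≡ ℤ→ℚ (↥ q ℤ.^ e ℤ.* (+ ↧ₙ q) ℤ.^ (N ∸ e))
↧^N*q^e≡↥^e*↧^[N∸e] q {N} {e} e≤N = begin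
  d ^ℚ N ℚ.* q ^ℚ e                     ≡⟨ cong (λ k → d ^ℚ k ℚ.* q ^ℚ e) (ℕP.m∸n+n≡m e≤N) ⟨
  d ^ℚ (N ∸ e ℕ.+ e) ℚ.* q ^ℚ e         ≡⟨ cong (ℚ._* q ^ℚ e) (^ℚ-homo-+ d (N ∸ e) e) ⟩
  (d ^ℚ (N ∸ e) ℚ.* d ^ℚ e) ℚ.* q ^ℚ e  ≡⟨ ℚP.*-assoc (d ^ℚ (N ∸ e)) _ _ ⟩
  d ^ℚ (N ∸ e) ℚ.* (d ^ℚ e ℚ.* q ^ℚ e)  ≡⟨ cong (d ^ℚ (N ∸ e) ℚ.*_) (^ℚ-distrib-* d q e) ⟨
  d ^ℚ (N ∸ e) ℚ.* (d ℚ.* q) ^ℚ e       ≡⟨ cong (λ x → d ^ℚ (N ∸ e) ℚ.* x ^ℚ e) (↧*q≡↥ q) ⟩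
  d ^ℚ (N ∸ e) ℚ.* ℤ→ℚ (↥ q) ^ℚ e       ≡⟨ ℚP.*-comm (d ^ℚ (N ∸ e)) _ ⟩
  ℤ→ℚ (↥ q) ^ℚ e ℚ.* d ^ℚ (N ∸ e)
    ≡⟨ cong₂ ℚ._*_ (ℤ→ℚ-homo-^ (↥ q) e) (ℤ→ℚ-homo-^ (+ ↧ₙ q) (N ∸ e)) ⟨
  ℤ→ℚ (↥ q ℤ.^ e) ℚ.* ℤ→ℚ ((+ ↧ₙ q) ℤ.^ (N ∸ e)) ≡⟨ ℤ→ℚ-homo-* (↥ q ℤ.^ e) _ ⟨
  ℤ→ℚ (↥ q ℤ.^ e ℤ.* (+ ↧ₙ q) ℤ.^ (N ∸ e)) ∎
  where
  open ≡-Reasoning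
  d = ℤ→ℚ (+ ↧ₙ q)

polyℚ : (ℕ → ℤ) → (ℕ → ℕ) → ℕ → ℚ → ℚ
polyℚ c e n z = sumTo n (λ j → ℤ→ℚ (c j) ℚ.* z ^ℚ e j)

polyℤ : (ℕ → ℤ) → (ℕ → ℕ) → ℕ → ℤ → ℤ
polyℤ c e n p = Σℤ n (λ j → c j ℤ.* p ℤ.^ e j)

polyℚ-ℤ→ℚ : ∀ c e n p → polyℚ c e n (ℤ→ℚ p) ≡ ℤ→ℚ (polyℤ c e n p)
polyℚ-ℤ→ℚ c e n p = begin
  polyℚ c e n (ℤ→ℚ p)                             ≡⟨ sumTo≡Σ≤ n _ ⟩
  Σ≤ ℚ._+_ n (λ j → ℤ→ℚ (c j) ℚ.* ℤ→ℚ p ^ℚ e j)  ≡⟨ Σ≤-cong ℚ._+_ n (λ j _ → sym (term j)) ⟩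
  Σ≤ ℚ._+_ n (λ j → ℤ→ℚ (c j ℤ.* p ℤ.^ e j))      ≡⟨ Σ≤-homo ℤ→ℚ ℤ→ℚ-homo-+ n _ ⟨
  ℤ→ℚ (polyℤ c e n p)                             ∎
  where
  open ≡-Reasoning
  term : ∀ j → ℤ→ℚ (c j ℤ.* p ℤ.^ e j) ≡ ℤ→ℚ (c j) ℚ.* ℤ→ℚ p ^ℚ e j
  term j = trans (ℤ→ℚ-homo-* (c j) _) (cong (ℤ→ℚ (c j) ℚ.*_) (ℤ→ℚ-homo-^ p (e j)))

polyℤ-pos : ∀ (a : ℕ → ℕ) e n k → polyℤ (λ j → + a j) e n (+ k) ≡ + Σℕ n (λ j → a j ℕ.* k ℕ.^ e j)
polyℤ-pos a e n k = begin
  polyℤ (λ j → + a j) e n (+ k)                ≡⟨ Σ≤-cong ℤ._+_ n (λ j _ → sym (term j)) ⟩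
  Σℤ n (λ j → + (a j ℕ.* k ℕ.^ e j))            ≡⟨ Σ≤-homo +_ ℤP.pos-+ n _ ⟨
  + Σℕ n (λ j → a j ℕ.* k ℕ.^ e j)              ∎
  where
  open ≡-Reasoning
  term : ∀ j → + (a j ℕ.* k ℕ.^ e j) ≡ + a j ℤ.* (+ k) ℤ.^ e j
  term j = trans (ℤP.pos-* (a j) _) (cong (+ a j ℤ.*_) (pos-^ k (e j)))

∣polyℤ∣≤ : ∀ c e n p E .{{_ : ℕ.NonZero ℤ.∣ p ∣}} → (∀ j → j ≤ n → e j ≤ E) →
           ℤ.∣ polyℤ c e n p ∣ ≤ Σℕ n (λ j → ℤ.∣ c j ∣) ℕ.* ℤ.∣ p ∣ ℕ.^ E
∣polyℤ∣≤ c e n p E e≤E = begin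
  ℤ.∣ polyℤ c e n p ∣                                 ≤⟨ ∣Σℤ∣≤Σℕ∣∣ n _ ⟩
  Σℕ n (λ j → ℤ.∣ c j ℤ.* p ℤ.^ e j ∣)                ≤⟨ Σℕ-mono-≤ n term ⟩
  Σℕ n (λ j → ℤ.∣ c j ∣ ℕ.* ℤ.∣ p ∣ ℕ.^ E)
    ≡⟨ Σ≤-homo (ℕ._* ℤ.∣ p ∣ ℕ.^ E) (ℕP.*-distribʳ-+ _) n _ ⟨
  Σℕ n (λ j → ℤ.∣ c j ∣) ℕ.* ℤ.∣ p ∣ ℕ.^ E            ∎
  where
  open ℕP.≤-Reasoning
  term : ∀ j → j ≤ n → ℤ.∣ c j ℤ.* p ℤ.^ e j ∣ ≤ ℤ.∣ c j ∣ ℕ.* ℤ.∣ p ∣ ℕ.^ E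
  term j j≤n = begin
    ℤ.∣ c j ℤ.* p ℤ.^ e j ∣          ≡⟨ ℤP.abs-* (c j) _ ⟩
    ℤ.∣ c j ∣ ℕ.* ℤ.∣ p ℤ.^ e j ∣    ≡⟨ cong (ℤ.∣ c j ∣ ℕ.*_) (abs-^ p (e j)) ⟩
    ℤ.∣ c j ∣ ℕ.* ℤ.∣ p ∣ ℕ.^ e j    ≤⟨ ℕP.*-monoʳ-≤ ℤ.∣ c j ∣ (ℕP.^-monoʳ-≤ ℤ.∣ p ∣ (e≤E j j≤n)) ⟩
    ℤ.∣ c j ∣ ℕ.* ℤ.∣ p ∣ ℕ.^ E      ∎

polyℤ≡Σ-mod-p-1 : ∀ c e n p → p ℤ.- 1ℤ ∣ polyℤ c e n p ℤ.- Σℤ n c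
polyℤ≡Σ-mod-p-1 c e zero    p =
  subst (p ℤ.- 1ℤ ∣_) (factor (c 0) (p ℤ.^ e 0)) (∣n⇒∣m*n (c 0) (m-1∣m^k-1 p (e 0)))
  where
  factor : ∀ c x → c ℤ.* (x ℤ.- 1ℤ) ≡ c ℤ.* x ℤ.- c
  factor = solve-∀
polyℤ≡Σ-mod-p-1 c e (suc n) p =
  subst (p ℤ.- 1ℤ ∣_) (regroup (polyℤ c e n p) (Σℤ n c) (c (suc n)) (p ℤ.^ e (suc n)))
    (∣m∣n⇒∣m+n (polyℤ≡Σ-mod-p-1 c e n p) (∣n⇒∣m*n (c (suc n)) (m-1∣m^k-1 p (e (suc n)))))
  where
  regroup : ∀ a s c x → (a ℤ.- s) ℤ.+ c ℤ.* (x ℤ.- 1ℤ) ≡ (a ℤ.+ c ℤ.* x) ℤ.- (s ℤ.+ c)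
  regroup = solve-∀

polyℚ-clear-denominators : ∀ c e n N q → (∀ j → j ≤ n → e j ≤ N) →
  ℤ→ℚ (+ ↧ₙ q) ^ℚ N ℚ.* polyℚ c e n q ≡
  ℤ→ℚ (Σℤ n (λ j → c j ℤ.* (↥ q ℤ.^ e j ℤ.* (+ ↧ₙ q) ℤ.^ (N ∸ e j))))
polyℚ-clear-denominators c e n N q e≤N = begin
  d^N ℚ.* polyℚ c e n q
    ≡⟨ cong (d^N ℚ.*_) (sumTo≡Σ≤ n _) ⟩
  d^N ℚ.* Σ≤ ℚ._+_ n (λ j → ℤ→ℚ (c j) ℚ.* q ^ℚ e j)
    ≡⟨ Σ≤-homo (d^N ℚ.*_) (ℚP.*-distribˡ-+ d^N) n _ ⟩
  Σ≤ ℚ._+_ n (λ j → d^N ℚ.* (ℤ→ℚ (c j) ℚ.* q ^ℚ e j))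
    ≡⟨ Σ≤-cong ℚ._+_ n term ⟩
  Σ≤ ℚ._+_ n (λ j → ℤ→ℚ (cleared j))
    ≡⟨ Σ≤-homo ℤ→ℚ ℤ→ℚ-homo-+ n _ ⟨
  ℤ→ℚ (Σℤ n cleared) ∎
  where
  open ≡-Reasoning
  d^N = ℤ→ℚ (+ ↧ₙ q) ^ℚ N
  cleared : ℕ → ℤ
  cleared j = c j ℤ.* (↥ q ℤ.^ e j ℤ.* (+ ↧ₙ q) ℤ.^ (N ∸ e j))
  term : ∀ j → j ≤ n → d^N ℚ.* (ℤ→ℚ (c j) ℚ.* q ^ℚ e j) ≡ ℤ→ℚ (cleared j)
  term j j≤n = begin
    d^N ℚ.* (ℤ→ℚ (c j) ℚ.* q ^ℚ e j)
      ≡⟨ ℚ*.x∙yz≈y∙xz d^N (ℤ→ℚ (c j)) (q ^ℚ e j) ⟩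
    ℤ→ℚ (c j) ℚ.* (d^N ℚ.* q ^ℚ e j)
      ≡⟨ cong (ℤ→ℚ (c j) ℚ.*_) (↧^N*q^e≡↥^e*↧^[N∸e] q (e≤N j j≤n)) ⟩
    ℤ→ℚ (c j) ℚ.* ℤ→ℚ (↥ q ℤ.^ e j ℤ.* (+ ↧ₙ q) ℤ.^ (N ∸ e j))
      ≡⟨ ℤ→ℚ-homo-* (c j) _ ⟨
    ℤ→ℚ (cleared j) ∎

↧ₙ≡1⇒≡ℤ→ℚ↥ : ∀ q → ↧ₙ q ≡ 1 → q ≡ ℤ→ℚ (↥ q)
↧ₙ≡1⇒≡ℤ→ℚ↥ (mkℚ p zero _) refl = sym (ℤ→ℚ≡mkℚ p)

-- After multiplying by ↧ q ^ N every term but the leading ↥ q ^ N is divisible by ↧ q,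
-- which is coprime to ↥ q.
monic-root-integral : ∀ c e n q → c (suc n) ≡ 1ℤ → (∀ j → j ≤ n → e j < e (suc n)) →
                      polyℚ c e (suc n) q ≡ 0ℚ → q ≡ ℤ→ℚ (↥ q)
monic-root-integral c e n q@(mkℚ p d p⊥d) c₁ e< root =
  ↧ₙ≡1⇒≡ℤ→ℚ↥ q (ℕ∣.∣1⇒≡1 (coprime-∣^⇒∣1 N (Coprimality.sym (Coprimality.recompute p⊥d)) D∣∣p∣^N))
  where
  N = e (suc n)
  D = + suc d
  term : ℕ → ℤ
  term j = c j ℤ.* (p ℤ.^ e j ℤ.* D ℤ.^ (N ∸ e j))
  e≤N : ∀ j → j ≤ suc n → e j ≤ N
  e≤N j j≤1+n with ℕP.m≤n⇒m<n∨m≡n j≤1+n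
  ... | inj₁ (s≤s j≤n) = ℕP.<⇒≤ (e< j j≤n)
  ... | inj₂ refl      = ℕP.≤-refl
  cleared : Σℤ n term ℤ.+ term (suc n) ≡ 0ℤ
  cleared = ℤ→ℚ-injective (begin
    ℤ→ℚ (Σℤ (suc n) term)                    ≡⟨ polyℚ-clear-denominators c e (suc n) N q e≤N ⟨
    ℤ→ℚ D ^ℚ N ℚ.* polyℚ c e (suc n) q       ≡⟨ cong (ℤ→ℚ D ^ℚ N ℚ.*_) root ⟩
    ℤ→ℚ D ^ℚ N ℚ.* 0ℚ                        ≡⟨ ℚP.*-zeroʳ (ℤ→ℚ D ^ℚ N) ⟩
    0ℚ                                       ∎)
    where open ≡-Reasoning
  leading : term (suc n) ≡ p ℤ.^ N
  leading = trans (cong₂ (λ a k → a ℤ.* (p ℤ.^ N ℤ.* D ℤ.^ k)) c₁ (ℕP.n∸n≡0 N)) (unit (p ℤ.^ N))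
    where
    unit : ∀ x → 1ℤ ℤ.* (x ℤ.* 1ℤ) ≡ x
    unit = solve-∀
  D∣term : ∀ j → j ≤ n → D ∣ term j
  D∣term j j≤n = ∣n⇒∣m*n (c j) (∣n⇒∣m*n (p ℤ.^ e j)
    (subst (λ k → D ∣ D ℤ.^ k) (sym (ℕP.+-∸-assoc 1 (e< j j≤n))) (∣m⇒∣m*n _ ∣-refl)))
  D∣p^N : D ∣ p ℤ.^ N
  D∣p^N = subst (D ∣_) leading
    (∣m+n∣m⇒∣n (subst (D ∣_) (sym cleared) (divides 0ℤ refl)) (∣-Σℤ n term D∣term))
  D∣∣p∣^N : suc d ℕ∣.∣ ℤ.∣ p ∣ ℕ.^ N
  D∣∣p∣^N = subst (suc d ℕ∣.∣_) (abs-^ p N) (∣⇒∣ᵤ D∣p^N)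

fℤ : ℕ → ℕ → ℤ → ℤ
fℤ m n = polyℤ (λ j → + (n C j)) (_C m) n

f-ℤ→ℚ : ∀ m n p → f m n (ℤ→ℚ p) ≡ ℤ→ℚ (fℤ m n p)
f-ℤ→ℚ m n = polyℚ-ℤ→ℚ (λ j → + (n C j)) (_C m) n

Σ-binomial-ℤ : ∀ n → Σℤ n (λ j → + (n C j)) ≡ + (2 ℕ.^ n)
Σ-binomial-ℤ n = trans (sym (Σ≤-homo +_ ℤP.pos-+ n (n C_))) (cong +_ (binomial-sum n))

sumTo-below : ∀ (a : ℕ → ℕ) m n r → n < m →
              sumTo n (λ j → ℕ→ℚ (a j) ℚ.* r ^ℚ (j C m)) ≡ ℕ→ℚ (Σℕ n a)
sumTo-below a m n r n<m = begin
  sumTo n (λ j → ℕ→ℚ (a j) ℚ.* r ^ℚ (j C m))       ≡⟨ sumTo≡Σ≤ n _ ⟩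
  Σ≤ ℚ._+_ n (λ j → ℕ→ℚ (a j) ℚ.* r ^ℚ (j C m))    ≡⟨ Σ≤-cong ℚ._+_ n constant ⟩
  Σ≤ ℚ._+_ n (λ j → ℕ→ℚ (a j))                      ≡⟨ Σ≤-homo ℕ→ℚ ℕ→ℚ-homo-+ n a ⟨
  ℕ→ℚ (Σℕ n a)                                      ∎
  where
  open ≡-Reasoning
  constant : ∀ j → j ≤ n → ℕ→ℚ (a j) ℚ.* r ^ℚ (j C m) ≡ ℕ→ℚ (a j)
  constant j j≤n = trans (cong (λ k → ℕ→ℚ (a j) ℚ.* r ^ℚ k) (k>n⇒nCk≡0 (ℕP.≤-<-trans j≤n n<m)))
                         (ℚP.*-identityʳ (ℕ→ℚ (a j)))

f-below≢0 : ∀ {m n} → n < m → ∀ r → f m n r ≢ 0ℚ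
f-below≢0 {m} {n} n<m r root = ℕP.<⇒≢ (ℕP.m^n>0 2 n) (sym (ℤP.+-injective (ℤ→ℚ-injective (begin
  ℕ→ℚ (2 ℕ.^ n)     ≡⟨ cong ℕ→ℚ (binomial-sum n) ⟨
  ℕ→ℚ (Σℕ n (n C_)) ≡⟨ sumTo-below (n C_) m n r n<m ⟨
  f m n r           ≡⟨ root ⟩
  0ℚ                ∎))))
  where open ≡-Reasoning

f-diagonal-root : ∀ {m} → 0 < m → ∀ r → f m m r ≡ 0ℚ → r ≡ 1ℚ - ℕ→ℚ 2 ^ℚ m
f-diagonal-root {suc k} _ r root = begin
  r                                 ≡⟨ isolate x r ⟩
  (1ℚ - (x ℚ.+ 1ℚ)) ℚ.+ (x ℚ.+ r)   ≡⟨ cong₂ (λ a b → (1ℚ - a) ℚ.+ b) (sym 2^m≡x+1) x+r≡0 ⟩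
  (1ℚ - ℕ→ℚ 2 ^ℚ m) ℚ.+ 0ℚ          ≡⟨ ℚP.+-identityʳ _ ⟩
  1ℚ - ℕ→ℚ 2 ^ℚ m                   ∎
  where
  open ≡-Reasoning
  open +-*-Solver
  m = suc k
  X = Σℕ k (m C_)
  x = ℕ→ℚ X
  isolate : ∀ x r → r ≡ (1ℚ - (x ℚ.+ 1ℚ)) ℚ.+ (x ℚ.+ r)
  isolate = solve 2 (λ x r → r := (con 1ℚ :- (x :+ con 1ℚ)) :+ (x :+ r)) refl
  leading : ℕ→ℚ (m C m) ℚ.* r ^ℚ (m C m) ≡ r
  leading = trans (cong₂ (λ a b → ℕ→ℚ a ℚ.* r ^ℚ b) (nCn≡1 m) (nCn≡1 m))
                  (trans (ℚP.*-identityˡ (r ℚ.* 1ℚ)) (ℚP.*-identityʳ r))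
  x+r≡0 : x ℚ.+ r ≡ 0ℚ
  x+r≡0 = trans (sym (cong₂ ℚ._+_ (sumTo-below (m C_) m k r (ℕP.n<1+n k)) leading)) root
  2^m≡x+1 : ℕ→ℚ 2 ^ℚ m ≡ x ℚ.+ 1ℚ
  2^m≡x+1 = begin
    ℕ→ℚ 2 ^ℚ m                 ≡⟨ ℕ→ℚ-homo-^ 2 m ⟨
    ℕ→ℚ (2 ℕ.^ m)              ≡⟨ cong ℕ→ℚ (binomial-sum m) ⟨
    ℕ→ℚ (X ℕ.+ m C m)          ≡⟨ cong (λ a → ℕ→ℚ (X ℕ.+ a)) (nCn≡1 m) ⟩
    ℕ→ℚ (X ℕ.+ 1)              ≡⟨ ℕ→ℚ-homo-+ X 1 ⟩
    x ℚ.+ 1ℚ                   ∎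

fℤ-nonneg≢0 : ∀ m n k → fℤ (suc m) n (+ k) ≢ 0ℤ
fℤ-nonneg≢0 m n k root = ℕP.<⇒≢ (Σℕ-head≤ n terms) (sym (ℤP.+-injective (begin
  + Σℕ n terms         ≡⟨ polyℤ-pos (n C_) (_C suc m) n k ⟨
  fℤ (suc m) n (+ k)   ≡⟨ root ⟩
  0ℤ                   ∎)))
  where
  open ≡-Reasoning
  terms : ℕ → ℕ
  terms j = (n C j) ℕ.* k ℕ.^ (j C suc m)

fℤ[-2]≢0 : ∀ m n → fℤ m n -[1+ 1 ] ≢ 0ℤ
fℤ[-2]≢0 m n root = 3∤2^n n (subst (3 ℕ∣.∣_) ∣0-2^n∣≡2^n (∣⇒∣ᵤ -3∣0-2^n))
  where
  -3∣0-2^n : -[1+ 2 ] ∣ 0ℤ ℤ.- + (2 ℕ.^ n)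
  -3∣0-2^n = subst₂ (λ a b → -[1+ 2 ] ∣ a ℤ.- b) root (Σ-binomial-ℤ n)
               (polyℤ≡Σ-mod-p-1 (λ j → + (n C j)) (_C m) n -[1+ 1 ])
  ∣0-2^n∣≡2^n : ℤ.∣ 0ℤ ℤ.- + (2 ℕ.^ n) ∣ ≡ 2 ℕ.^ n
  ∣0-2^n∣≡2^n = trans (cong ℤ.∣_∣ (ℤP.+-identityˡ (ℤ.- + (2 ℕ.^ n)))) (ℤP.∣-i∣≡∣i∣ (+ (2 ℕ.^ n)))

fℤ-large≢0 : ∀ {m n} s → 2 ≤ m → m < n → fℤ m n -[1+ suc (suc s) ] ≢ 0ℤ
fℤ-large≢0 {suc m} {suc n} s (s≤s 0<m) (s≤s m<n) root =
  ℕP.n≮n X (ℕP.*-cancelʳ-≤ (suc X) X Y {{ℕP.m^n≢0 S N'}} (ℕP.≤-trans lower upper))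
  where
  p = -[1+ suc (suc s) ]
  S = ℤ.∣ p ∣
  N = suc n C suc m
  N' = n C suc m
  c : ℕ → ℤ
  c j = + (suc n C j)
  e : ℕ → ℕ
  e j = j C suc m
  X = Σℕ n (suc n C_)
  Y = S ℕ.^ N'
  leading : c (suc n) ℤ.* p ℤ.^ N ≡ p ℤ.^ N
  leading = trans (cong (λ a → + a ℤ.* p ℤ.^ N) (nCn≡1 (suc n))) (ℤP.*-identityˡ (p ℤ.^ N))
  p^N≡-rest : p ℤ.^ N ≡ ℤ.- polyℤ c e n p
  p^N≡-rest = ℤ+.inverseʳ-unique (polyℤ c e n p) (p ℤ.^ N)
                (trans (cong (λ x → polyℤ c e n p ℤ.+ x) (sym leading)) root)
  upper : S ℕ.^ N ≤ X ℕ.* Y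
  upper = begin
    S ℕ.^ N                 ≡⟨ abs-^ p N ⟨
    ℤ.∣ p ℤ.^ N ∣           ≡⟨ cong ℤ.∣_∣ p^N≡-rest ⟩
    ℤ.∣ ℤ.- polyℤ c e n p ∣ ≡⟨ ℤP.∣-i∣≡∣i∣ (polyℤ c e n p) ⟩
    ℤ.∣ polyℤ c e n p ∣     ≤⟨ ∣polyℤ∣≤ c e n p N' (λ j j≤n → C-monoˡ-≤ (suc m) j≤n) ⟩
    X ℕ.* Y                 ∎
    where open ℕP.≤-Reasoning
  1+X≡2^[1+n] : suc X ≡ 2 ℕ.^ suc n
  1+X≡2^[1+n] = begin
    suc X                          ≡⟨ ℕP.+-comm 1 X ⟩
    X ℕ.+ 1                        ≡⟨ cong (X ℕ.+_) (nCn≡1 (suc n)) ⟨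
    Σℕ (suc n) (suc n C_)          ≡⟨ binomial-sum (suc n) ⟩
    2 ℕ.^ suc n                    ∎
    where open ≡-Reasoning
  3≤S : 3 ≤ S
  3≤S = s≤s (s≤s (s≤s z≤n))
  lower : suc X ℕ.* Y ≤ S ℕ.^ N
  lower = begin
    suc X ℕ.* Y                         ≡⟨ cong (ℕ._* Y) 1+X≡2^[1+n] ⟩
    2 ℕ.^ suc n ℕ.* Y                   ≤⟨ ℕP.*-monoˡ-≤ Y (2^[1+n]≤3^nCk 0<m m<n) ⟩
    3 ℕ.^ (n C m) ℕ.* Y                 ≤⟨ ℕP.*-monoˡ-≤ Y (ℕP.^-monoˡ-≤ (n C m) 3≤S) ⟩
    S ℕ.^ (n C m) ℕ.* S ℕ.^ N'          ≡⟨ ℕP.^-distribˡ-+-* S (n C m) N' ⟨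
    S ℕ.^ (n C m ℕ.+ N')                ≡⟨ cong (S ℕ.^_) (pascal n m) ⟩
    S ℕ.^ N                             ∎
    where open ℕP.≤-Reasoning

fℤ-root : ∀ {m n} p → 2 ≤ m → m < n → fℤ m n p ≡ 0ℤ → p ≡ -1ℤ
fℤ-root {suc m} {n} (+ k)              _   _   root = ⊥-elim (fℤ-nonneg≢0 m n k root)
fℤ-root             -[1+ 0 ]           _   _   _    = refl
fℤ-root {m}     {n} -[1+ 1 ]           _   _   root = ⊥-elim (fℤ[-2]≢0 m n root)
fℤ-root             -[1+ suc (suc s) ] 2≤m m<n root = ⊥-elim (fℤ-large≢0 s 2≤m m<n root)

f-above-root : ∀ {m n} → 2 ≤ m → m < n → ∀ r → f m n r ≡ 0ℚ → r ≡ - 1ℚ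
f-above-root {m} {suc n} 2≤m (s≤s m≤n) r root = begin
  r              ≡⟨ r-integral ⟩
  ℤ→ℚ (↥ r)      ≡⟨ cong ℤ→ℚ (fℤ-root (↥ r) 2≤m (s≤s m≤n) integral-root) ⟩
  ℤ→ℚ -1ℤ        ∎
  where
  open ≡-Reasoning
  r-integral : r ≡ ℤ→ℚ (↥ r)
  r-integral = monic-root-integral (λ j → + (suc n C j)) (_C m) n r (cong +_ (nCn≡1 (suc n)))
    (λ j j≤n → ℕP.≤-<-trans (C-monoˡ-≤ m j≤n) (nCk<[1+n]Ck (ℕP.<-≤-trans (s≤s z≤n) 2≤m) m≤n)) root
  integral-root : fℤ m (suc n) (↥ r) ≡ 0ℤ
  integral-root = ℤ→ℚ-injective (begin
    ℤ→ℚ (fℤ m (suc n) (↥ r))   ≡⟨ f-ℤ→ℚ m (suc n) (↥ r) ⟨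
    f m (suc n) (ℤ→ℚ (↥ r))    ≡⟨ cong (f m (suc n)) r-integral ⟨
    f m (suc n) r              ≡⟨ root ⟩
    0ℚ                         ∎)

lemma4p1 : (m n : ℕ) → m ≥ 2 → (r : ℚ) → f m n r ≡ 0ℚ →
    (r ≡ - 1ℚ) ⊎ ((n ≡ m) × (r ≡ 1ℚ - (ℕ→ℚ 2 ^ℚ m)))
lemma4p1 m n 2≤m r root with ℕP.<-cmp n m
... | tri< n<m _ _ = ⊥-elim (f-below≢0 n<m r root)
... | tri≈ _ refl _ = inj₂ (refl , f-diagonal-root (ℕP.<-≤-trans (s≤s z≤n) 2≤m) r root)
... | tri> _ _ m<n = inj₁ (f-above-root 2≤m m<n r root)
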